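{- If $\Lambda=T_1\sqcup\cdots\sqcup T_m$ is a partition of $\Lambda$ into $m$ pairwise disjoint nonempty tilings, then $m\le n-2$.
   Context: Fix an integer $n\ge 2$, $[n]=\{1,\dots,n\}$, and let $\Lambda$ be the set of triples $ijk$ with $i<j<k$ in $[n]$. For a quadruple $i<j<k<l$, its stick is the ordered sequence $(ijk,ijl,ikl,jkl)$. A subset of $\Lambda$ is a tiling if for every quadruple $i<j<k<l$ its intersection with the stick, written as a 0/1 string along the stick order, is one of $0000,1000,1100,1110,1111,0111,0011,0001$ (these are the inversion sets of rhombus tilings of the zonogon $Z(n;2)$). -}

module Defs where

open import Data.Nat using (ℕ)
open import Data.Fin using (Fin; _<_)
open import Data.Bool using (Bool; true; false)
open import Data.Vec using (Vec; []; _∷_)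
open import Data.List using (List; []; _∷_)
open import Data.List.Membership.Propositional using (_∈_)
open import Data.Product using (_×_; ∃)
open import Relation.Binary.PropositionalEquality using (_≡_; _≢_)
open import Relation.Nullary using (¬_)

-- [n] = {1,…,n} is modelled by Fin n (0-indexed, same linear order).
-- Λ : the set of triples ijk with i < j < k.
record Triple (n : ℕ) : Set where
  constructor triple
  field
    i j k : Fin n
    i<j : i < j
    j<k : j < k

SubsetΛ : ℕ → Set
SubsetΛ n = Triple n → Bool

allowedPatterns : List (Vec Bool 4)
allowedPatterns =
    (false ∷ false ∷ false ∷ false ∷ [])
  ∷ (true  ∷ false ∷ false ∷ false ∷ [])
  ∷ (true  ∷ true  ∷ false ∷ false ∷ [])
  ∷ (true  ∷ true  ∷ true  ∷ false ∷ [])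
  ∷ (true  ∷ true  ∷ true  ∷ true  ∷ [])
  ∷ (false ∷ true  ∷ true  ∷ true  ∷ [])
  ∷ (false ∷ false ∷ true  ∷ true  ∷ [])
  ∷ (false ∷ false ∷ false ∷ true  ∷ [])
  ∷ []

IsTiling : ∀ {n} → SubsetΛ n → Set
IsTiling {n} T =
  ∀ (i j k l : Fin n) (i<j : i < j) (j<k : j < k) (k<l : k < l) →
    let j<l = Data.Fin.Properties.<-trans j<k k<l
        i<k = Data.Fin.Properties.<-trans i<j j<k
    in (T (triple i j k i<j j<k) ∷ T (triple i j l i<j j<l)
         ∷ T (triple i k l i<k k<l) ∷ T (triple j k l j<k k<l) ∷ [])
       ∈ allowedPatterns
  where import Data.Fin.Properties

Nonempty : ∀ {n} → SubsetΛ n → Set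
Nonempty {n} T = ∃ λ (t : Triple n) → T t ≡ true

IsPartitionIntoNonemptyTilings : ∀ {n} (m : ℕ) → (Fin m → SubsetΛ n) → Set
IsPartitionIntoNonemptyTilings {n} m T =
    (∀ a → IsTiling (T a))
  × (∀ a → Nonempty (T a))
  × (∀ a b → a ≢ b → ∀ (t : Triple n) → ¬ (T a t ≡ true × T b t ≡ true))
  × (∀ (t : Triple n) → ∃ λ a → T a t ≡ true)

module Submission where

open import Defs
open import Data.Nat using (ℕ; _≤_; _∸_)
open import Data.Fin using (Fin)
open import Data.Nat as ℕ using (suc; z≤n; s≤s)
open import Data.Nat.Properties as ℕ using (m≤n⇒m<n∨m≡n; ∸-monoˡ-<; ∸-monoʳ-<)
open import Data.Nat.Induction using (<-wellFounded)
open import Data.Fin using (_<_; toℕ; fromℕ<; _≟_)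
open import Data.Fin.Properties
  using (toℕ<n; toℕ-fromℕ<; toℕ-injective; <-irrelevant; injective⇒≤)
open import Data.Bool using (true)
open import Data.Vec using ([]; _∷_)
open import Data.List.Relation.Unary.Any using (here; there)
open import Data.List.Membership.Propositional using (_∈_)
open import Data.Product using (_×_; _,_; proj₁; proj₂; ∃)
open import Data.Sum using (_⊎_; inj₁; inj₂)
open import Function using (_on_)
open import Function.Definitions using (Injective)
open import Induction.WellFounded using (Acc; acc)
import Relation.Binary.Construct.On as On
open import Relation.Binary.PropositionalEquality
open import Relation.Nullary using (yes; no; contradiction)

-- Every nonempty tiling contains a triple of consecutive numbers w, w+1, w+2.
-- Indeed, if a triple ijk of T has a gap, inserting a number x into the gap
-- makes ijk an interior element of the stick of the quadruple ijk ∪ {x}; every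
-- admissible pattern with an interior 1 has a 1 at one of its ends, and both
-- ends have a shorter span than ijk. Disjoint tilings therefore yield distinct
-- starting points w ∈ {1, …, n−2}.

stick-interior⇒end : ∀ {a b c d} → (a ∷ b ∷ c ∷ d ∷ []) ∈ allowedPatterns →
  b ≡ true ⊎ c ≡ true → a ≡ true ⊎ d ≡ true
stick-interior⇒end (here refl) (inj₁ ())
stick-interior⇒end (here refl) (inj₂ ())
stick-interior⇒end (there (here refl)) _ = inj₁ refl
stick-interior⇒end (there (there (here refl))) _ = inj₁ refl
stick-interior⇒end (there (there (there (here refl)))) _ = inj₁ refl
stick-interior⇒end (there (there (there (there (here refl))))) _ = inj₁ refl
stick-interior⇒end (there (there (there (there (there (here refl)))))) _ = inj₂ refl
stick-interior⇒end (there (there (there (there (there (there (here refl))))))) _ = inj₂ refl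
stick-interior⇒end (there (there (there (there (there (there (there (here refl)))))))) _ = inj₂ refl
stick-interior⇒end (there (there (there (there (there (there (there (there ())))))))) _

module _ {n : ℕ} where

  open Triple

  triple-≡ : ∀ {i j k i′ j′ k′ : Fin n} {p q p′ q′} →
    i ≡ i′ → j ≡ j′ → k ≡ k′ → triple i j k p q ≡ triple i′ j′ k′ p′ q′
  triple-≡ refl refl refl = cong₂ (triple _ _ _) (<-irrelevant _ _) (<-irrelevant _ _)

  span : Triple n → ℕ
  span t = toℕ (k t) ∸ toℕ (i t)

  _⊏_ : Triple n → Triple n → Set
  _⊏_ = ℕ._<_ on span

  Consecutive : Triple n → Set
  Consecutive t = toℕ (j t) ≡ suc (toℕ (i t)) × toℕ (k t) ≡ suc (toℕ (j t))

  consecutive-injective : ∀ {s t} → Consecutive s → Consecutive t →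
    toℕ (i s) ≡ toℕ (i t) → s ≡ t
  consecutive-injective {s} {t} (js , ks) (jt , kt) i≡ =
    triple-≡ (toℕ-injective i≡) (toℕ-injective j≡) (toℕ-injective k≡)
    where
      j≡ : toℕ (j s) ≡ toℕ (j t)
      j≡ = trans js (trans (cong suc i≡) (sym jt))
      k≡ : toℕ (k s) ≡ toℕ (k t)
      k≡ = trans ks (trans (cong suc j≡) (sym kt))

  consecutive⇒i<n∸2 : ∀ t → Consecutive t → toℕ (i t) ℕ.< n ∸ 2
  consecutive⇒i<n∸2 t (js , ks) =
    ∸-monoˡ-< (subst (ℕ._< n) (trans ks (cong suc js)) (toℕ<n (k t))) (s≤s (s≤s z≤n))

  Gap : Triple n → Set
  Gap t = suc (toℕ (i t)) ℕ.< toℕ (j t) ⊎ suc (toℕ (j t)) ℕ.< toℕ (k t)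

  consecutive-or-gap : (t : Triple n) → Consecutive t ⊎ Gap t
  consecutive-or-gap t with m≤n⇒m<n∨m≡n (i<j t) | m≤n⇒m<n∨m≡n (j<k t)
  ... | inj₁ gapˡ | _         = inj₂ (inj₁ gapˡ)
  ... | inj₂ _    | inj₁ gapʳ = inj₂ (inj₂ gapʳ)
  ... | inj₂ ij   | inj₂ jk   = inj₁ (sym ij , sym jk)

  successor-between : ∀ (a b : Fin n) → suc (toℕ a) ℕ.< toℕ b →
    ∃ λ x → a < x × x < b
  successor-between a b gap =
    x , subst (toℕ a ℕ.<_) (sym x≡) (ℕ.n<1+n _) , subst (ℕ._< toℕ b) (sym x≡) gap
    where
      x : Fin n
      x = fromℕ< (ℕ.<-trans gap (toℕ<n b))
      x≡ : toℕ x ≡ suc (toℕ a)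
      x≡ = toℕ-fromℕ< _

  module _ {T : SubsetΛ n} (tiling : IsTiling T) where

    interior∈⇒shorter∈ : ∀ (a b c d : Fin n) (a<b : a < b) (b<c : b < c) (c<d : c < d) →
      T (triple a b d a<b (ℕ.<-trans b<c c<d)) ≡ true ⊎
      T (triple a c d (ℕ.<-trans a<b b<c) c<d) ≡ true →
      ∃ λ t′ → span t′ ℕ.< toℕ d ∸ toℕ a × T t′ ≡ true
    interior∈⇒shorter∈ a b c d a<b b<c c<d interior
      with stick-interior⇒end (tiling a b c d a<b b<c c<d) interior
    ... | inj₁ abc = triple a b c a<b b<c , ∸-monoˡ-< c<d (ℕ.<⇒≤ (ℕ.<-trans a<b b<c)) , abc
    ... | inj₂ bcd = triple b c d b<c c<d , ∸-monoʳ-< a<b (ℕ.<⇒≤ (ℕ.<-trans b<c c<d)) , bcd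

    ∈-irrelevant : ∀ {a b c : Fin n} {p q p′ q′} →
      T (triple a b c p q) ≡ true → T (triple a b c p′ q′) ≡ true
    ∈-irrelevant = subst (λ t → T t ≡ true) (triple-≡ refl refl refl)

    gap⇒shorter∈ : ∀ t → Gap t → T t ≡ true → ∃ λ t′ → t′ ⊏ t × T t′ ≡ true
    gap⇒shorter∈ (triple a b d a<b b<d) (inj₁ gapˡ) Tt
      with successor-between a b gapˡ
    ... | x , a<x , x<b =
      interior∈⇒shorter∈ a x b d a<x x<b b<d (inj₂ (∈-irrelevant Tt))
    gap⇒shorter∈ (triple a b d a<b b<d) (inj₂ gapʳ) Tt
      with successor-between b d gapʳ
    ... | x , b<x , x<d =
      interior∈⇒shorter∈ a b x d a<b b<x x<d (inj₁ (∈-irrelevant Tt))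

    consecutive∈ : ∀ t → Acc _⊏_ t → T t ≡ true → ∃ λ c → Consecutive c × T c ≡ true
    consecutive∈ t (acc shorter) Tt with consecutive-or-gap t
    ... | inj₁ consecutive = t , consecutive , Tt
    ... | inj₂ gap with gap⇒shorter∈ t gap Tt
    ...   | t′ , t′⊏t , Tt′ = consecutive∈ t′ (shorter t′⊏t) Tt′

    nonempty⇒consecutive∈ : Nonempty T → ∃ λ c → Consecutive c × T c ≡ true
    nonempty⇒consecutive∈ (t , Tt) = consecutive∈ t (On.wellFounded span <-wellFounded t) Tt

mainTheorem11 : ∀ (n : ℕ) → 2 ≤ n → ∀ (m : ℕ) (T : Fin m → SubsetΛ n) →
    IsPartitionIntoNonemptyTilings m T → m ≤ n ∸ 2
mainTheorem11 n _ m T (tiling , nonempty , disjoint , _) = injective⇒≤ start-injective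
  where
    consecutive∈T : ∀ a → ∃ λ c → Consecutive c × T a c ≡ true
    consecutive∈T a = nonempty⇒consecutive∈ (tiling a) (nonempty a)

    c : Fin m → Triple n
    c a = proj₁ (consecutive∈T a)

    c-consecutive : ∀ a → Consecutive (c a)
    c-consecutive a = proj₁ (proj₂ (consecutive∈T a))

    c∈T : ∀ a → T a (c a) ≡ true
    c∈T a = proj₂ (proj₂ (consecutive∈T a))

    start : Fin m → Fin (n ∸ 2)
    start a = fromℕ< (consecutive⇒i<n∸2 (c a) (c-consecutive a))

    start-injective : Injective _≡_ _≡_ start
    start-injective {a} {b} start≡ with a ≟ b
    ... | yes a≡b = a≡b
    ... | no a≢b = contradiction (c∈T a , subst (λ t → T b t ≡ true) (sym c≡) (c∈T b))
                                 (disjoint a b a≢b (c a))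
      where
        c≡ : c a ≡ c b
        c≡ = consecutive-injective (c-consecutive a) (c-consecutive b)
               (trans (sym (toℕ-fromℕ< _)) (trans (cong toℕ start≡) (toℕ-fromℕ< _)))
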